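{- Let $\eta_x$ be a polynomial umbra and let $\alpha$ and $\gamma$ be umbrae which are either both scalar or both polynomial. Then $\eta_\alpha\equiv\eta_\gamma$ if and only if $\alpha\equiv\gamma$.
   Context: Setting (classical umbral calculus). $R$ is a commutative integral domain whose quotient field has characteristic $0$; polynomial rings over $R$ in indeterminates may serve as scalars. Umbrae are symbols of an alphabet $A$ with a linear evaluation $E$ on $R[A]$, $E[1]=1$, multiplicative on products of powers of pairwise distinct umbrae. Moments of $\alpha$: $E[\alpha^n]$. $p\simeq q$ means $E[p]=E[q]$; $\alpha\equiv\gamma$ (similar) means $\alpha^n\simeq\gamma^n$ for all $n\ge0$. An umbra is scalar if its moments lie in $R$, polynomial if its moments are polynomials (in some indeterminates). A polynomial umbra $\eta_x$ is an umbra whose moments are polynomials $q_n(x)=\sum_{k=0}^n q_{n,k}x^k\in R[x]$ with $q_0=1$ and $\deg q_n=n$. For an umbra $\alpha$, $\eta_\alpha$ denotes an umbra with moments $E[\eta_\alpha^n]=E[q_n(\alpha)]=\sum_{k}q_{n,k}E[\alpha^k]$. -}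

module Defs where

open import Level using (Level; _⊔_)
open import Data.Nat using (ℕ; zero; suc; _<_)
open import Data.Sum using (_⊎_)
open import Relation.Nullary using (¬_)
open import Algebra.Bundles using (CommutativeRing)
open import Algebra.Morphism.Structures using (IsRingHomomorphism)

private variable c ℓ c′ ℓ′ : Level

record IsIntegralDomain (R : CommutativeRing c ℓ) : Set (c ⊔ ℓ) where
  open CommutativeRing R
  field
    1≉0            : ¬ (1# ≈ 0#)
    noZeroDivisors : ∀ x y → x * y ≈ 0# → (x ≈ 0#) ⊎ (y ≈ 0#)

ofℕ : (R : CommutativeRing c ℓ) → ℕ → CommutativeRing.Carrier R
ofℕ R zero    = CommutativeRing.0# R
ofℕ R (suc n) = CommutativeRing._+_ R (CommutativeRing.1# R) (ofℕ R n)

-- characteristic 0 (for an integral domain, equivalent to its quotient field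
-- having characteristic 0)
CharZero : CommutativeRing c ℓ → Set ℓ
CharZero R = ∀ n → ¬ (CommutativeRing._≈_ R (ofℕ R (suc n)) (CommutativeRing.0# R))

-- The ring S of scalars in which moments live: R itself (scalar umbrae) or a
-- polynomial ring over R (polynomial umbrae); abstractly an integral domain S
-- together with an injective ring homomorphism ι : R → S.
record Extension (R : CommutativeRing c ℓ) (S : CommutativeRing c′ ℓ′)
       : Set (c ⊔ ℓ ⊔ c′ ⊔ ℓ′) where
  field
    ι         : CommutativeRing.Carrier R → CommutativeRing.Carrier S
    isRingHom : IsRingHomomorphism (CommutativeRing.rawRing R)
                                   (CommutativeRing.rawRing S) ι
    injective : ∀ x y → CommutativeRing._≈_ S (ι x) (ι y)
                      → CommutativeRing._≈_ R x y

-- An umbra is determined (up to similarity) by its moment sequence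
-- n ↦ E[α^n] with values in S.
Moments : CommutativeRing c′ ℓ′ → Set c′
Moments S = ℕ → CommutativeRing.Carrier S

Similar : (S : CommutativeRing c′ ℓ′) → Moments S → Moments S → Set ℓ′
Similar S α γ = ∀ n → CommutativeRing._≈_ S (α n) (γ n)

-- A polynomial umbra η_x: moments q_n(x) = Σ_{k=0}^n q n k x^k ∈ R[x],
-- with q_0 = 1 and deg q_n = n (coefficients above degree n vanish,
-- the coefficient of x^n is nonzero).
record PolynomialUmbra (R : CommutativeRing c ℓ) : Set (c ⊔ ℓ) where
  open CommutativeRing R
  field
    q        : ℕ → ℕ → Carrier
    q₀       : q 0 0 ≈ 1#
    q-above  : ∀ n k → n < k → q n k ≈ 0#
    q-leading : ∀ n → ¬ (q n n ≈ 0#)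

sumUpTo : (S : CommutativeRing c′ ℓ′) → (ℕ → CommutativeRing.Carrier S)
        → ℕ → CommutativeRing.Carrier S
sumUpTo S f zero    = f 0
sumUpTo S f (suc n) = CommutativeRing._+_ S (sumUpTo S f n) (f (suc n))

subst-η : {R : CommutativeRing c ℓ} {S : CommutativeRing c′ ℓ′}
        → PolynomialUmbra R → Extension R S → Moments S → Moments S
subst-η {S = S} η E α n =
  sumUpTo S (λ k → CommutativeRing._*_ S (Extension.ι E (PolynomialUmbra.q η n k)) (α k)) n

-- The moments of η_α form a lower triangular linear system in the moments of α,
-- E[η_α^n] = Σ_{k≤n} q_{n,k} E[α^k], whose diagonal entries q_{n,n} stay nonzero
-- in S because ι is injective. Over the integral domain S such a system can be
-- solved by forward substitution, so the moments of η_α determine those of α.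
module Submission where

open import Defs
open import Level using (Level)
open import Algebra.Bundles using (CommutativeRing)
open import Algebra.Morphism.Structures using (module IsRingHomomorphism)
open import Function.Bundles using (_⇔_; mk⇔)
open import Data.Nat using (ℕ; zero; suc; _≤_; z≤n; s≤s)
open import Data.Nat.Properties using (≤-refl; m≤n⇒m≤1+n; m≤n⇒m<n∨m≡n)
open import Data.Sum using (inj₁; inj₂)
open import Data.Empty using (⊥-elim)
open import Relation.Nullary using (¬_)
open import Relation.Binary.PropositionalEquality using (refl)
import Algebra.Definitions as AlgebraDefinitions
import Algebra.Properties.Ring as RingProperties
import Algebra.Properties.Group as GroupProperties

module _ {c ℓ : Level} (S : CommutativeRing c ℓ) where
  open CommutativeRing S

  sumUpTo-cong : ∀ {f g : ℕ → Carrier} n →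
                 (∀ {k} → k ≤ n → f k ≈ g k) → sumUpTo S f n ≈ sumUpTo S g n
  sumUpTo-cong zero    f≈g = f≈g z≤n
  sumUpTo-cong (suc n) f≈g =
    +-cong (sumUpTo-cong n (λ k≤n → f≈g (m≤n⇒m≤1+n k≤n))) (f≈g ≤-refl)

module IntegralDomainProperties {c ℓ : Level} {S : CommutativeRing c ℓ}
                                (domain : IsIntegralDomain S) where
  open CommutativeRing S
  open IsIntegralDomain domain
  open AlgebraDefinitions _≈_ using (AlmostLeftCancellative)
  open RingProperties ring using (x[y-z]≈xy-xz)
  open GroupProperties +-group using (x∙y⁻¹≈ε⇒x≈y; ∙-cancelˡ)
  open import Relation.Binary.Reasoning.Setoid setoid

  *-cancelˡ-nonZero : AlmostLeftCancellative 0# _*_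
  *-cancelˡ-nonZero a x y a≉0 ax≈ay
    with noZeroDivisors a (x - y) a[x-y]≈0
    where
    a[x-y]≈0 : a * (x - y) ≈ 0#
    a[x-y]≈0 = begin
      a * (x - y)    ≈⟨ x[y-z]≈xy-xz a x y ⟩
      a * x - a * y  ≈⟨ +-congʳ ax≈ay ⟩
      a * y - a * y  ≈⟨ -‿inverseʳ (a * y) ⟩
      0#             ∎
  ... | inj₁ a≈0   = ⊥-elim (a≉0 a≈0)
  ... | inj₂ x-y≈0 = x∙y⁻¹≈ε⇒x≈y x y x-y≈0

  module _ (a : ℕ → ℕ → Carrier) (a-diagonal≉0 : ∀ n → ¬ (a n n ≈ 0#))
           (x y : ℕ → Carrier) where

    Row : (ℕ → Carrier) → ℕ → Carrier
    Row z n = sumUpTo S (λ k → a n k * z k) n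

    triangular-agreeUpTo : (∀ n → Row x n ≈ Row y n) → ∀ n {k} → k ≤ n → x k ≈ y k
    triangular-agreeUpTo rows≈ zero z≤n =
      *-cancelˡ-nonZero (a 0 0) (x 0) (y 0) (a-diagonal≉0 0) (rows≈ 0)
    triangular-agreeUpTo rows≈ (suc n) k≤1+n with m≤n⇒m<n∨m≡n k≤1+n
    ... | inj₁ (s≤s k≤n) = triangular-agreeUpTo rows≈ n k≤n
    ... | inj₂ refl      =
      *-cancelˡ-nonZero (a (suc n) (suc n)) (x (suc n)) (y (suc n))
                        (a-diagonal≉0 (suc n)) (∙-cancelˡ _ _ _ row≈)
      where
      earlier≈ : sumUpTo S (λ k → a (suc n) k * x k) n ≈ sumUpTo S (λ k → a (suc n) k * y k) n
      earlier≈ = sumUpTo-cong S n (λ k≤n → *-congˡ (triangular-agreeUpTo rows≈ n k≤n))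

      row≈ : sumUpTo S (λ k → a (suc n) k * y k) n + a (suc n) (suc n) * x (suc n)
           ≈ sumUpTo S (λ k → a (suc n) k * y k) n + a (suc n) (suc n) * y (suc n)
      row≈ = trans (+-congʳ (sym earlier≈)) (rows≈ (suc n))

    triangular-injective : (∀ n → Row x n ≈ Row y n) → ∀ n → x n ≈ y n
    triangular-injective rows≈ n = triangular-agreeUpTo rows≈ n ≤-refl

module _ {c ℓ c′ ℓ′ : Level} {R : CommutativeRing c ℓ} {S : CommutativeRing c′ ℓ′}
         (E : Extension R S) where
  private
    module R = CommutativeRing R
    module S = CommutativeRing S
  open Extension E
  open IsRingHomomorphism isRingHom using (0#-homo)

  ι-nonZero : ∀ {x} → ¬ (x R.≈ R.0#) → ¬ (ι x S.≈ S.0#)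
  ι-nonZero x≉0 ιx≈0 = x≉0 (injective _ _ (S.trans ιx≈0 (S.sym 0#-homo)))

  subst-η-cong : (η : PolynomialUmbra R) {α γ : Moments S} →
                 Similar S α γ → Similar S (subst-η η E α) (subst-η η E γ)
  subst-η-cong η α≡γ n = sumUpTo-cong S n (λ {k} _ → S.*-congˡ (α≡γ k))

-- Only S needs to be an integral domain.
proposition4p1 : ∀ {c ℓ c′ ℓ′ : Level}
    (R : CommutativeRing c ℓ) → IsIntegralDomain R → CharZero R →
    (S : CommutativeRing c′ ℓ′) → IsIntegralDomain S → (E : Extension R S) →
    (η : PolynomialUmbra R) → (α γ : Moments S) →
    Similar S (subst-η η E α) (subst-η η E γ) ⇔ Similar S α γ
proposition4p1 R _ _ S domainS E η α γ =
  mk⇔ (triangular-injective (λ n k → ι (q n k)) (λ n → ι-nonZero E (q-leading n)) α γ)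
      (subst-η-cong E η)
  where
  open Extension E using (ι)
  open PolynomialUmbra η using (q; q-leading)
  open IntegralDomainProperties domainS using (triangular-injective)
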